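{- Let $G_1$ be a generator matrix of a quaternary Hermitian LCD $[n_1,k,d_1]$ code and let $G_2$ be a generator matrix of a quaternary Hermitian self-orthogonal $[n_2,k,d_2]$ code. Then the code with generator matrix $(G_1\ G_2)$ (the $k\times(n_1+n_2)$ matrix obtained by juxtaposition) is a quaternary Hermitian LCD $[n_1+n_2,k,d']$ code with $d'\ge d_1+d_2$.
   Context: $\mathbb{F}_4=\{0,1,\omega,\omega^2\}$ with $\omega^2=\omega+1$, $\overline{x}=x^2$. A quaternary $[n,k,d]$ code is a $k$-dimensional subspace of $\mathbb{F}_4^n$ with minimum nonzero Hamming weight $d$. The Hermitian dual of $C$ is $C^{\perp_H}=\{x : \sum_i x_i\overline{y_i}=0\ \forall y\in C\}$. $C$ is Hermitian LCD if $C\cap C^{\perp_H}=\{0\}$, and Hermitian self-orthogonal if $C\subseteq C^{\perp_H}$. -}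

module Defs where

open import Data.Nat using (ℕ; zero; suc; _≤_)
import Data.Nat as ℕ
open import Data.Fin using (Fin; zero; suc)
open import Data.Product using (Σ; ∃; _×_; _,_)
open import Data.Vec.Functional using (Vector; _++_)
open import Relation.Binary.PropositionalEquality using (_≡_)
open import Relation.Nullary using (¬_)

-- The field F4 = {0, 1, ω, ω²} with ω² = ω + 1 (characteristic 2)

data F4 : Set where
  𝟎 𝟏 ω ω² : F4

infixl 6 _+_
infixl 7 _*_

_+_ : F4 → F4 → F4
𝟎  + y  = y
x  + 𝟎  = x
𝟏  + 𝟏  = 𝟎
𝟏  + ω  = ω²
𝟏  + ω² = ω
ω  + 𝟏  = ω²
ω  + ω  = 𝟎
ω  + ω² = 𝟏
ω² + 𝟏  = ω
ω² + ω  = 𝟏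
ω² + ω² = 𝟎

_*_ : F4 → F4 → F4
𝟎  * y  = 𝟎
x  * 𝟎  = 𝟎
𝟏  * y  = y
x  * 𝟏  = x
ω  * ω  = ω²
ω  * ω² = 𝟏
ω² * ω  = 𝟏
ω² * ω² = ω

conj : F4 → F4
conj x = x * x

Σᶠ : (n : ℕ) → (Fin n → F4) → F4
Σᶠ zero    f = 𝟎
Σᶠ (suc n) f = f zero + Σᶠ n (λ i → f (suc i))

Matrix : ℕ → ℕ → Set
Matrix k n = Fin k → Fin n → F4

_≈_ : {n : ℕ} → Vector F4 n → Vector F4 n → Set
x ≈ y = ∀ i → x i ≡ y i

zeroVec : {n : ℕ} → Vector F4 n
zeroVec _ = 𝟎

wt : {n : ℕ} → Vector F4 n → ℕ
wt {zero}  x = zero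
wt {suc n} x with x zero
... | 𝟎 = wt (λ i → x (suc i))
... | _ = suc (wt (λ i → x (suc i)))

lincomb : {k n : ℕ} → Matrix k n → Vector F4 k → Vector F4 n
lincomb {k} G a j = Σᶠ k (λ i → a i * G i j)

⟨_,_⟩ₕ : {n : ℕ} → Vector F4 n → Vector F4 n → F4
⟨_,_⟩ₕ {n} x y = Σᶠ n (λ i → x i * conj (y i))

Code : ℕ → Set₁
Code n = Vector F4 n → Set

rowSpace : {k n : ℕ} → Matrix k n → Code n
rowSpace G x = ∃ λ a → x ≈ lincomb G a

hermDual : {n : ℕ} → Code n → Code n
hermDual C x = ∀ y → C y → ⟨ x , y ⟩ₕ ≡ 𝟎

HermitianLCD : {n : ℕ} → Code n → Set
HermitianLCD C = ∀ x → C x → hermDual C x → x ≈ zeroVec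

HermitianSelfOrthogonal : {n : ℕ} → Code n → Set
HermitianSelfOrthogonal C = ∀ x → C x → hermDual C x

HasMinDist : {n : ℕ} → Code n → ℕ → Set
HasMinDist C d =
  (∃ λ x → C x × ¬ (x ≈ zeroVec) × wt x ≡ d) ×
  (∀ x → C x → ¬ (x ≈ zeroVec) → d ≤ wt x)

-- G (k × n) is a generator matrix of an [n,k,d] code:
-- its rows are linearly independent (so the row space has dimension k)
-- and the row space has minimum distance d
IsGenMatrix : {k n : ℕ} → Matrix k n → ℕ → Set
IsGenMatrix G d =
  (∀ a → lincomb G a ≈ zeroVec → a ≈ zeroVec) × HasMinDist (rowSpace G) d

juxt : {k n₁ n₂ : ℕ} → Matrix k n₁ → Matrix k n₂ → Matrix k (n₁ ℕ.+ n₂)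
juxt G₁ G₂ i = G₁ i ++ G₂ i

-- A codeword of (G₁ G₂) is aG₁ ++ aG₂, so its weight is wt(aG₁) + wt(aG₂), and both halves are
-- nonzero when a ≠ 0 since the rows of G₁ and of G₂ are independent. Inner products also split:
-- ⟨aG, bG⟩ = ⟨aG₁, bG₁⟩ + ⟨aG₂, bG₂⟩, and the second summand vanishes because G₂ spans a
-- self-orthogonal code. Hence if aG is orthogonal to the whole code, aG₁ is orthogonal to the code
-- of G₁, so aG₁ = 0 by the LCD property and a = 0 by independence of the rows of G₁.
-- The minimum distance of the juxtaposed code exists because F₄ᵏ is finite: it is the weight of
-- aG for a nonzero message a minimising that weight.
module Submission where

open import Defs
open import Data.Nat using (ℕ; zero; suc; _≤_)
import Data.Nat as ℕ
open import Data.Nat.Properties using (+-mono-≤)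
open import Data.Product using (∃; _×_; _,_)
open import Data.Fin using (Fin; zero; suc; splitAt; _↑ˡ_)
open import Data.Fin.Properties using (all?)
open import Data.Sum using (inj₁; inj₂)
open import Data.Sum.Properties using ([,]-map)
open import Data.Vec.Functional using (Vector; _++_; tail)
import Data.Vec.Functional as Vector
open import Data.Vec.Functional.Properties using (lookup-++ˡ)
open import Data.List using (List; []; _∷_; [_]; cartesianProductWith; filter)
open import Data.List.Membership.Propositional using (_∈_)
open import Data.List.Membership.Propositional.Properties using (∈-cartesianProductWith⁺; ∈-filter⁺)
open import Data.List.Relation.Unary.Any using (here; there)
import Data.List.Relation.Unary.All as All
open import Data.List.Relation.Unary.All.Properties using (all-filter)
open import Data.List.Extrema.Nat using (argmin; argmin-all; f[argmin]≤f[xs])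
open import Function using (_∘_)
open import Relation.Binary.PropositionalEquality using (_≡_; refl; sym; trans; cong; cong₂; subst; _≗_; module ≡-Reasoning)
open import Relation.Nullary using (¬_; Dec; yes; no)
open import Relation.Nullary.Decidable using (¬?)
open import Relation.Unary using (Decidable)

private
  variable
    k m n n₁ n₂ : ℕ

+-identityʳ : ∀ x → x + 𝟎 ≡ x
+-identityʳ 𝟎  = refl
+-identityʳ 𝟏  = refl
+-identityʳ ω  = refl
+-identityʳ ω² = refl

+-assoc : ∀ x y z → (x + y) + z ≡ x + (y + z)
+-assoc 𝟎 y z = refl
+-assoc x 𝟎 z = cong (_+ z) (+-identityʳ x)
+-assoc x y 𝟎 = trans (+-identityʳ (x + y)) (cong (x +_) (sym (+-identityʳ y)))
+-assoc 𝟏  𝟏  𝟏  = refl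
+-assoc 𝟏  𝟏  ω  = refl
+-assoc 𝟏  𝟏  ω² = refl
+-assoc 𝟏  ω  𝟏  = refl
+-assoc 𝟏  ω  ω  = refl
+-assoc 𝟏  ω  ω² = refl
+-assoc 𝟏  ω² 𝟏  = refl
+-assoc 𝟏  ω² ω  = refl
+-assoc 𝟏  ω² ω² = refl
+-assoc ω  𝟏  𝟏  = refl
+-assoc ω  𝟏  ω  = refl
+-assoc ω  𝟏  ω² = refl
+-assoc ω  ω  𝟏  = refl
+-assoc ω  ω  ω  = refl
+-assoc ω  ω  ω² = refl
+-assoc ω  ω² 𝟏  = refl
+-assoc ω  ω² ω  = refl
+-assoc ω  ω² ω² = refl
+-assoc ω² 𝟏  𝟏  = refl
+-assoc ω² 𝟏  ω  = refl
+-assoc ω² 𝟏  ω² = refl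
+-assoc ω² ω  𝟏  = refl
+-assoc ω² ω  ω  = refl
+-assoc ω² ω  ω² = refl
+-assoc ω² ω² 𝟏  = refl
+-assoc ω² ω² ω  = refl
+-assoc ω² ω² ω² = refl

_≟𝟎 : (x : F4) → Dec (x ≡ 𝟎)
𝟎  ≟𝟎 = yes refl
𝟏  ≟𝟎 = no λ ()
ω  ≟𝟎 = no λ ()
ω² ≟𝟎 = no λ ()

zeroVec? : (x : Vector F4 n) → Dec (x ≈ zeroVec)
zeroVec? x = all? (λ i → x i ≟𝟎)

tail-++ : ∀ {A : Set} (x : Vector A (suc m)) (y : Vector A n) → tail (x ++ y) ≗ tail x ++ y
tail-++ {m = m} x y i = [,]-map (splitAt m i)

Σᶠ-cong : ∀ n {f g : Fin n → F4} → f ≗ g → Σᶠ n f ≡ Σᶠ n g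
Σᶠ-cong zero    f≗g = refl
Σᶠ-cong (suc n) f≗g = cong₂ _+_ (f≗g zero) (Σᶠ-cong n (f≗g ∘ suc))

Σᶠ-zero : ∀ n → Σᶠ n (λ _ → 𝟎) ≡ 𝟎
Σᶠ-zero zero    = refl
Σᶠ-zero (suc n) = Σᶠ-zero n

Σᶠ-++ : ∀ m (f : Vector F4 m) (g : Vector F4 n) → Σᶠ (m ℕ.+ n) (f ++ g) ≡ Σᶠ m f + Σᶠ n g
Σᶠ-++ zero    f g = refl
Σᶠ-++ {n} (suc m) f g = begin
  f zero + Σᶠ (m ℕ.+ n) (tail (f ++ g))  ≡⟨ cong (f zero +_) (Σᶠ-cong (m ℕ.+ n) (tail-++ f g)) ⟩
  f zero + Σᶠ (m ℕ.+ n) (tail f ++ g)    ≡⟨ cong (f zero +_) (Σᶠ-++ m (tail f) g) ⟩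
  f zero + (Σᶠ m (tail f) + Σᶠ n g)      ≡⟨ +-assoc (f zero) _ _ ⟨
  (f zero + Σᶠ m (tail f)) + Σᶠ n g      ∎
  where open ≡-Reasoning

wt-cong : {x y : Vector F4 n} → x ≈ y → wt x ≡ wt y
wt-cong {zero}          x≈y = refl
wt-cong {suc n} {x} {y} x≈y with x zero | y zero | x≈y zero
... | 𝟎  | .𝟎  | refl = wt-cong (x≈y ∘ suc)
... | 𝟏  | .𝟏  | refl = cong suc (wt-cong (x≈y ∘ suc))
... | ω  | .ω  | refl = cong suc (wt-cong (x≈y ∘ suc))
... | ω² | .ω² | refl = cong suc (wt-cong (x≈y ∘ suc))

wt-++ : (x : Vector F4 m) (y : Vector F4 n) → wt (x ++ y) ≡ wt x ℕ.+ wt y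
wt-++ {zero}  x y = refl
wt-++ {suc m} x y with x zero | trans (wt-cong (tail-++ x y)) (wt-++ (tail x) y)
... | 𝟎  | wt-tail = wt-tail
... | 𝟏  | wt-tail = cong suc wt-tail
... | ω  | wt-tail = cong suc wt-tail
... | ω² | wt-tail = cong suc wt-tail

⟨⟩ₕ-cong : {x x′ y y′ : Vector F4 n} → x ≈ x′ → y ≈ y′ → ⟨ x , y ⟩ₕ ≡ ⟨ x′ , y′ ⟩ₕ
⟨⟩ₕ-cong {n} x≈x′ y≈y′ = Σᶠ-cong n (λ i → cong₂ (λ u v → u * conj v) (x≈x′ i) (y≈y′ i))

⟨⟩ₕ-++ : (x₁ y₁ : Vector F4 m) (x₂ y₂ : Vector F4 n) →
         ⟨ x₁ ++ x₂ , y₁ ++ y₂ ⟩ₕ ≡ ⟨ x₁ , y₁ ⟩ₕ + ⟨ x₂ , y₂ ⟩ₕ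
⟨⟩ₕ-++ {m} {n} x₁ y₁ x₂ y₂ = trans (Σᶠ-cong (m ℕ.+ n) termwise) (Σᶠ-++ m _ _)
  where
  termwise : ∀ i → (x₁ ++ x₂) i * conj ((y₁ ++ y₂) i)
                 ≡ ((λ j → x₁ j * conj (y₁ j)) ++ (λ j → x₂ j * conj (y₂ j))) i
  termwise i with splitAt m i
  ... | inj₁ _ = refl
  ... | inj₂ _ = refl

lincomb∈rowSpace : (G : Matrix k n) (a : Vector F4 k) → rowSpace G (lincomb G a)
lincomb∈rowSpace G a = a , λ _ → refl

lincomb-cong : (G : Matrix k n) {a b : Vector F4 k} → a ≈ b → lincomb G a ≈ lincomb G b
lincomb-cong {k} G a≈b j = Σᶠ-cong k (λ i → cong (_* G i j) (a≈b i))

lincomb-zero : (G : Matrix k n) {a : Vector F4 k} {x : Vector F4 n} →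
               x ≈ lincomb G a → a ≈ zeroVec → x ≈ zeroVec
lincomb-zero {k} G x≈Ga a≈0 j = trans (x≈Ga j) (trans (lincomb-cong G a≈0 j) (Σᶠ-zero k))

lincomb-juxt : (G₁ : Matrix k n₁) (G₂ : Matrix k n₂) (a : Vector F4 k) →
               lincomb (juxt G₁ G₂) a ≈ (lincomb G₁ a ++ lincomb G₂ a)
lincomb-juxt {n₁ = n₁} G₁ G₂ a j with splitAt n₁ j
... | inj₁ _ = refl
... | inj₂ _ = refl

wt-lincomb-juxt : (G₁ : Matrix k n₁) (G₂ : Matrix k n₂) (a : Vector F4 k) →
                  wt (lincomb (juxt G₁ G₂) a) ≡ wt (lincomb G₁ a) ℕ.+ wt (lincomb G₂ a)
wt-lincomb-juxt G₁ G₂ a =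
  trans (wt-cong (lincomb-juxt G₁ G₂ a)) (wt-++ (lincomb G₁ a) (lincomb G₂ a))

⟨⟩ₕ-lincomb-juxt : (G₁ : Matrix k n₁) (G₂ : Matrix k n₂) (a b : Vector F4 k) →
                   ⟨ lincomb (juxt G₁ G₂) a , lincomb (juxt G₁ G₂) b ⟩ₕ
                   ≡ ⟨ lincomb G₁ a , lincomb G₁ b ⟩ₕ + ⟨ lincomb G₂ a , lincomb G₂ b ⟩ₕ
⟨⟩ₕ-lincomb-juxt G₁ G₂ a b =
  trans (⟨⟩ₕ-cong (lincomb-juxt G₁ G₂ a) (lincomb-juxt G₁ G₂ b))
        (⟨⟩ₕ-++ (lincomb G₁ a) (lincomb G₁ b) (lincomb G₂ a) (lincomb G₂ b))

RowsIndependent : Matrix k n → Set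
RowsIndependent G = ∀ a → lincomb G a ≈ zeroVec → a ≈ zeroVec

juxt-rowsIndependent : {G₁ : Matrix k n₁} (G₂ : Matrix k n₂) →
                       RowsIndependent G₁ → RowsIndependent (juxt G₁ G₂)
juxt-rowsIndependent {n₂ = n₂} {G₁} G₂ indep₁ a Ga≈0 = indep₁ a λ i → begin
  lincomb G₁ a i                                   ≡⟨ lookup-++ˡ (lincomb G₁ a) (lincomb G₂ a) i ⟨
  (lincomb G₁ a ++ lincomb G₂ a) (i ↑ˡ n₂)         ≡⟨ lincomb-juxt G₁ G₂ a (i ↑ˡ n₂) ⟨
  lincomb (juxt G₁ G₂) a (i ↑ˡ n₂)                 ≡⟨ Ga≈0 (i ↑ˡ n₂) ⟩
  𝟎                                                ∎
  where open ≡-Reasoning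

juxt-hermitianLCD : {G₁ : Matrix k n₁} {G₂ : Matrix k n₂} →
                    RowsIndependent G₁ → HermitianLCD (rowSpace G₁) →
                    HermitianSelfOrthogonal (rowSpace G₂) → HermitianLCD (rowSpace (juxt G₁ G₂))
juxt-hermitianLCD {k = k} {n₁ = n₁} {n₂ = n₂} {G₁ = G₁} {G₂} indep₁ lcd₁ so₂ x (a , x≈Ga) x⊥C =
  lincomb-zero G x≈Ga (indep₁ a (lcd₁ (lincomb G₁ a) (lincomb∈rowSpace G₁ a) G₁a⊥C₁))
  where
  G : Matrix k (n₁ ℕ.+ n₂)
  G = juxt G₁ G₂
  open ≡-Reasoning
  G₁a⊥C₁ : hermDual (rowSpace G₁) (lincomb G₁ a)
  G₁a⊥C₁ y (b , y≈G₁b) = begin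
    ⟨ lincomb G₁ a , y ⟩ₕ
      ≡⟨ ⟨⟩ₕ-cong {x = lincomb G₁ a} (λ _ → refl) y≈G₁b ⟩
    ⟨ lincomb G₁ a , lincomb G₁ b ⟩ₕ
      ≡⟨ +-identityʳ _ ⟨
    ⟨ lincomb G₁ a , lincomb G₁ b ⟩ₕ + 𝟎
      ≡⟨ cong (⟨ lincomb G₁ a , lincomb G₁ b ⟩ₕ +_) (so₂ _ (lincomb∈rowSpace G₂ a) _ (lincomb∈rowSpace G₂ b)) ⟨
    ⟨ lincomb G₁ a , lincomb G₁ b ⟩ₕ + ⟨ lincomb G₂ a , lincomb G₂ b ⟩ₕ
      ≡⟨ ⟨⟩ₕ-lincomb-juxt G₁ G₂ a b ⟨
    ⟨ lincomb G a , lincomb G b ⟩ₕ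
      ≡⟨ ⟨⟩ₕ-cong {y = lincomb G b} x≈Ga (λ _ → refl) ⟨
    ⟨ x , lincomb G b ⟩ₕ
      ≡⟨ x⊥C (lincomb G b) (lincomb∈rowSpace G b) ⟩
    𝟎 ∎

juxt-wt-≥ : {G₁ : Matrix k n₁} {G₂ : Matrix k n₂} {d₁ d₂ : ℕ} →
            RowsIndependent G₁ → RowsIndependent G₂ →
            (∀ x → rowSpace G₁ x → ¬ x ≈ zeroVec → d₁ ≤ wt x) →
            (∀ x → rowSpace G₂ x → ¬ x ≈ zeroVec → d₂ ≤ wt x) →
            ∀ x → rowSpace (juxt G₁ G₂) x → ¬ x ≈ zeroVec → d₁ ℕ.+ d₂ ≤ wt x
juxt-wt-≥ {G₁ = G₁} {G₂} {d₁} {d₂} indep₁ indep₂ min₁ min₂ x (a , x≈Ga) x≢0 =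
  subst (d₁ ℕ.+ d₂ ≤_) (trans (sym (wt-lincomb-juxt G₁ G₂ a)) (sym (wt-cong x≈Ga)))
    (+-mono-≤ (min₁ (lincomb G₁ a) (lincomb∈rowSpace G₁ a) (a≢0 ∘ indep₁ a))
              (min₂ (lincomb G₂ a) (lincomb∈rowSpace G₂ a) (a≢0 ∘ indep₂ a)))
  where
  a≢0 : ¬ a ≈ zeroVec
  a≢0 = x≢0 ∘ lincomb-zero (juxt G₁ G₂) x≈Ga

vectors : ∀ k → List (Vector F4 k)
vectors zero    = [ Vector.[] ]
vectors (suc k) = cartesianProductWith Vector._∷_ (𝟎 ∷ 𝟏 ∷ ω ∷ ω² ∷ []) (vectors k)

∈-vectors : (a : Vector F4 k) → ∃ λ c → c ∈ vectors k × a ≈ c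
∈-vectors {zero}  a = Vector.[] , here refl , λ ()
∈-vectors {suc k} a with ∈-vectors (tail a)
... | c , c∈ , tail-a≈c = a zero Vector.∷ c , ∈-cartesianProductWith⁺ Vector._∷_ (head∈ (a zero)) c∈ , a≈
  where
  head∈ : ∀ x → x ∈ 𝟎 ∷ 𝟏 ∷ ω ∷ ω² ∷ []
  head∈ 𝟎  = here refl
  head∈ 𝟏  = there (here refl)
  head∈ ω  = there (there (here refl))
  head∈ ω² = there (there (there (here refl)))
  a≈ : a ≈ (a zero Vector.∷ c)
  a≈ zero    = refl
  a≈ (suc i) = tail-a≈c i

-- Without function extensionality, vectors is complete only up to ≈, so P and f must respect ≈.
∃-minimiser : {P : Vector F4 k → Set} → Decidable P → (f : Vector F4 k → ℕ) →
              (∀ {a b} → a ≈ b → P a → P b) → (∀ {a b} → a ≈ b → f a ≡ f b) →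
              ∀ a₀ → P a₀ → ∃ λ a → P a × ∀ b → P b → f a ≤ f b
∃-minimiser {k} {P} P? f P-resp f-resp a₀ Pa₀ =
  a , argmin-all f Pa₀ (all-filter P? (vectors k)) , minimal
  where
  candidates : List (Vector F4 k)
  candidates = filter P? (vectors k)
  a : Vector F4 k
  a = argmin f a₀ candidates
  minimal : ∀ b → P b → f a ≤ f b
  minimal b Pb with ∈-vectors b
  ... | c , c∈ , b≈c = subst (f a ≤_) (sym (f-resp b≈c))
          (All.lookup (f[argmin]≤f[xs] a₀ candidates) (∈-filter⁺ P? c∈ (P-resp b≈c Pb)))

rowSpace-hasMinDist : (G : Matrix k n) (a₀ : Vector F4 k) → ¬ lincomb G a₀ ≈ zeroVec →
                      ∃ λ d → HasMinDist (rowSpace G) d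
rowSpace-hasMinDist G a₀ Ga₀≢0
  with ∃-minimiser (λ a → ¬? (zeroVec? (lincomb G a))) (wt ∘ lincomb G)
         (λ a≈b Ga≢0 Gb≈0 → Ga≢0 (λ j → trans (lincomb-cong G a≈b j) (Gb≈0 j)))
         (wt-cong ∘ lincomb-cong G) a₀ Ga₀≢0
... | a , Ga≢0 , minimal =
  wt (lincomb G a) , (lincomb G a , lincomb∈rowSpace G a , Ga≢0 , refl) ,
  λ { x (b , x≈Gb) x≢0 → subst (wt (lincomb G a) ≤_) (sym (wt-cong x≈Gb))
                           (minimal b (λ Gb≈0 → x≢0 (λ j → trans (x≈Gb j) (Gb≈0 j)))) }

hasMinDist-≥ : {C : Code n} {d e : ℕ} → HasMinDist C d →
               (∀ x → C x → ¬ x ≈ zeroVec → e ≤ wt x) → e ≤ d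
hasMinDist-≥ ((x , x∈C , x≢0 , refl) , _) bound = bound x x∈C x≢0

lemma2p3 : (k n₁ n₂ d₁ d₂ : ℕ) (G₁ : Matrix k n₁) (G₂ : Matrix k n₂) →
    IsGenMatrix G₁ d₁ → HermitianLCD (rowSpace G₁) →
    IsGenMatrix G₂ d₂ → HermitianSelfOrthogonal (rowSpace G₂) →
    HermitianLCD (rowSpace (juxt G₁ G₂)) ×
    (∃ λ d′ → IsGenMatrix (juxt G₁ G₂) d′ × d₁ ℕ.+ d₂ ≤ d′)
lemma2p3 k n₁ n₂ d₁ d₂ G₁ G₂ (indep₁ , (x₁ , (a₁ , x₁≈G₁a₁) , x₁≢0 , _) , min₁) lcd₁
         (indep₂ , _ , min₂) so₂
  with rowSpace-hasMinDist (juxt G₁ G₂) a₁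
         (x₁≢0 ∘ lincomb-zero G₁ x₁≈G₁a₁ ∘ juxt-rowsIndependent G₂ indep₁ a₁)
... | d′ , minDist =
  juxt-hermitianLCD indep₁ lcd₁ so₂ ,
  d′ , (juxt-rowsIndependent G₂ indep₁ , minDist) ,
  hasMinDist-≥ minDist (juxt-wt-≥ indep₁ indep₂ min₁ min₂)
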